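{- A Burling graph contains no triangle (three pairwise adjacent vertices).
   Context: Rooted trees: for a rooted tree $(T,r)$ and $v\neq r$, $p(v)$ is the parent of $v$. A branch is a path $v_1v_2\dots v_k$ of $T$ with $v_i$ the parent of $v_{i+1}$ for all $i$ (it starts at $v_1$); a branch may be empty. A Burling tree is a 4-tuple $(T,r,\ell,c)$ where $T$ is a rooted tree with root $r$; $\ell$ assigns to every non-leaf vertex $v$ one of its children $\ell(v)$, the last-born of $v$; and $c$ is a function on $V(T)$ such that if $v\neq r$ is not a last-born then $c(v)$ is the vertex set of a (possibly empty) branch of $T$ starting at $\ell(p(v))$, while $c(v)=\varnothing$ if $v$ is the root or a last-born. The oriented graph fully derived from the Burling tree has vertex set $V(T)$ and an arc $uv$ iff $v\in c(u)$. An oriented graph is derived from the Burling tree if it is an induced subgraph of the fully derived oriented graph. A (non-oriented) Burling graph is the underlying graph of an oriented graph derived from some Burling tree. -}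

module Defs where

open import Data.Nat using (ℕ)
open import Data.Fin using (Fin)
open import Data.Maybe using (Maybe; just; nothing)
open import Data.List using (List; []; _∷_)
open import Data.List.Membership.Propositional using (_∈_)
open import Data.Product using (Σ; _×_; ∃)
open import Data.Sum using (_⊎_)
open import Relation.Binary.PropositionalEquality using (_≡_; _≢_)
open import Relation.Nullary using (¬_)
open import Function.Bundles using (_⇔_)
open import Function.Definitions using (Injective)

-- Acyclicity/connectedness: every vertex reaches the root by a finite
-- parent chain (inductive, hence finite).

module _ {n : ℕ} (r : Fin n) (parent : Fin n → Maybe (Fin n)) where

  data ReachesRoot : Fin n → Set where
    atRoot : ∀ {v} → v ≡ r → ReachesRoot v
    up     : ∀ {v u} → parent v ≡ just u → ReachesRoot u → ReachesRoot v

record RootedTree (n : ℕ) : Set where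
  field
    root        : Fin n
    parent      : Fin n → Maybe (Fin n)
    root-parent : parent root ≡ nothing
    nonroot-parent : ∀ v → parent v ≡ nothing → v ≡ root
    reaches     : ∀ v → ReachesRoot root parent v

  IsParent : Fin n → Fin n → Set
  IsParent u v = parent v ≡ just u

  IsLeaf : Fin n → Set
  IsLeaf v = ∀ w → ¬ IsParent v w

  data IsBranch : List (Fin n) → Set where
    []-branch  : IsBranch []
    [-]-branch : ∀ v → IsBranch (v ∷ [])
    ∷-branch   : ∀ {u v vs} → IsParent u v → IsBranch (v ∷ vs) → IsBranch (u ∷ v ∷ vs)

  data IsBranchFrom (s : Fin n) : List (Fin n) → Set where
    empty    : IsBranchFrom s []
    nonempty : ∀ {vs} → IsBranch (s ∷ vs) → IsBranchFrom s (s ∷ vs)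

-- Burling trees (T, r, ℓ, c).  ℓ is a total function, constrained only on
-- non-leaf vertices (its values on leaves are irrelevant).
-- c v is a list whose vertex set is c(v).

record BurlingTree (n : ℕ) : Set where
  field
    tree : RootedTree n
  open RootedTree tree public
  field
    lastBorn : Fin n → Fin n
    lastBorn-child : ∀ v → ¬ IsLeaf v → IsParent v (lastBorn v)
    c : Fin n → List (Fin n)
    c-root : c root ≡ []
    c-lastBorn : ∀ v u → IsParent u v → lastBorn u ≡ v → c v ≡ []
    c-other    : ∀ v u → IsParent u v → lastBorn u ≢ v → IsBranchFrom (lastBorn u) (c v)

  Arc : Fin n → Fin n → Set
  Arc u v = v ∈ c u

  Adj : Fin n → Fin n → Set
  Adj u v = Arc u v ⊎ Arc v u

record Graph (m : ℕ) : Set₁ where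
  field
    Edge : Fin m → Fin m → Set

-- G is a Burling graph: G is the underlying graph of an oriented graph
-- derived from some Burling tree, i.e. of an induced subgraph of the fully
-- derived oriented graph.  The induced subgraph is given by an injective
-- map from V(G) into V(T).
IsBurlingGraph : ∀ {m} → Graph m → Set
IsBurlingGraph {m} G =
  Σ ℕ λ n → Σ (BurlingTree n) λ B → Σ (Fin m → Fin n) λ f →
    Injective _≡_ _≡_ f ×
    (∀ x y → Graph.Edge G x y ⇔ BurlingTree.Adj B (f x) (f y))

HasTriangle : ∀ {m} → Graph m → Set
HasTriangle {m} G = Σ (Fin m) λ x → Σ (Fin m) λ y → Σ (Fin m) λ z →
  x ≢ y × y ≢ z × x ≢ z ×
  Graph.Edge G x y × Graph.Edge G y z × Graph.Edge G x z

{-# OPTIONS --safe #-}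
-- An arc u → v goes into the branch c(u), which starts at the last-born
-- sibling s of u; so v descends from s, whence depth u ≤ depth v and u, v are
-- incomparable in the ancestor order.  Two out-neighbours of u lie on one
-- branch, hence are comparable, hence non-adjacent.  Around a directed
-- 3-cycle the depth cannot grow, so each arc u → v is level, which forces
-- v = s; but a last-born has no out-arcs.  Every orientation of a triangle
-- either has a vertex with two out-neighbours or is a directed 3-cycle.
module Submission where

open import Defs
open import Data.Nat using (ℕ; zero; suc; _≤_)
open import Data.Nat.Properties using (≤-refl; ≤-trans; ≤-antisym; m≤n⇒m≤1+n; 1+n≰n)
open import Data.Fin using (Fin)
open import Data.Maybe using (just; nothing)
open import Data.Maybe.Properties using (just-injective)
open import Data.List using ([]; _∷_)
open import Data.List.Relation.Unary.Any using (here; there)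
open import Data.List.Membership.Propositional using (_∈_)
open import Data.Product using (_,_)
open import Data.Sum using (_⊎_; inj₁; inj₂)
open import Data.Empty using (⊥-elim)
open import Function using (flip)
open import Function.Bundles using (Equivalence)
open import Relation.Binary.Construct.Closure.ReflexiveTransitive using (Star; ε; _◅_; _◅◅_)
open import Relation.Binary.PropositionalEquality using (_≡_; _≢_; refl; sym; trans; cong; subst)
open import Relation.Nullary using (¬_)

module _ {A : Set} (R : A → A → Set) where

  Symmetrised : A → A → Set
  Symmetrised x y = R x y ⊎ R y x

  triangle-free :
    (∀ {u p q} → R u p → R u q → ¬ Symmetrised p q) →
    (∀ {a b c} → R a b → R b c → ¬ R c a) →
    ∀ {a b c} → Symmetrised a b → Symmetrised b c → ¬ Symmetrised a c
  triangle-free fork cycle (inj₁ ab) bc        (inj₁ ac) = fork ab ac bc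
  triangle-free fork cycle (inj₁ ab) (inj₁ bc) (inj₂ ca) = cycle ab bc ca
  triangle-free fork cycle (inj₁ ab) (inj₂ cb) (inj₂ ca) = fork ca cb (inj₁ ab)
  triangle-free fork cycle (inj₂ ba) (inj₁ bc) ac        = fork ba bc ac
  triangle-free fork cycle (inj₂ ba) (inj₂ cb) (inj₁ ac) = cycle ac cb ba
  triangle-free fork cycle (inj₂ ba) (inj₂ cb) (inj₂ ca) = fork ca cb (inj₂ ba)

module RootedTreeProperties {n : ℕ} (T : RootedTree n) where
  open RootedTree T

  -- w ↠ a : a is w or an ancestor of w.
  _↠_ : Fin n → Fin n → Set
  _↠_ = Star (flip IsParent)

  Comparable : Fin n → Fin n → Set
  Comparable x y = x ↠ y ⊎ y ↠ x

  length : ∀ {v} → ReachesRoot root parent v → ℕ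
  length (atRoot _) = zero
  length (up _ p)   = suc (length p)

  length-unique : ∀ {v} (p q : ReachesRoot root parent v) → length p ≡ length q
  length-unique (atRoot _)    (atRoot _)   = refl
  length-unique (atRoot refl) (up e _)     with () ← trans (sym e) root-parent
  length-unique (up e _)      (atRoot refl) with () ← trans (sym e) root-parent
  length-unique (up e p)      (up e′ q)    with refl ← just-injective (trans (sym e) e′) =
    cong suc (length-unique p q)

  depth : Fin n → ℕ
  depth v = length (reaches v)

  depth-child : ∀ {u v} → IsParent u v → depth v ≡ suc (depth u)
  depth-child {u} {v} e = length-unique (reaches v) (up e (reaches u))

  ↠-depth-≤ : ∀ {w a} → w ↠ a → depth a ≤ depth w
  ↠-depth-≤ ε       = ≤-refl
  ↠-depth-≤ (e ◅ p) rewrite depth-child e = m≤n⇒m≤1+n (↠-depth-≤ p)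

  ↠-depth-≡ : ∀ {w a} → w ↠ a → depth a ≡ depth w → a ≡ w
  ↠-depth-≡ ε       _ = refl
  ↠-depth-≡ (e ◅ p) d rewrite depth-child e = ⊥-elim (1+n≰n (subst (_≤ _) d (↠-depth-≤ p)))

  ↠-unique-at-depth : ∀ {w a b} → w ↠ a → w ↠ b → depth a ≡ depth b → a ≡ b
  ↠-unique-at-depth ε        q        d = sym (↠-depth-≡ q (sym d))
  ↠-unique-at-depth (e ◅ p)  ε        d = ↠-depth-≡ (e ◅ p) d
  ↠-unique-at-depth (e ◅ p)  (e′ ◅ q) d with refl ← just-injective (trans (sym e) e′) =
    ↠-unique-at-depth p q d

  branch-member-↠-head : ∀ {s vs x} → IsBranch (s ∷ vs) → x ∈ s ∷ vs → x ↠ s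
  branch-member-↠-head _               (here refl)  = ε
  branch-member-↠-head (∷-branch e br) (there x∈vs) = branch-member-↠-head br x∈vs ◅◅ (e ◅ ε)

  branch-members-comparable : ∀ {vs x y} → IsBranch vs → x ∈ vs → y ∈ vs → Comparable x y
  branch-members-comparable br              (here refl) y∈ = inj₂ (branch-member-↠-head br y∈)
  branch-members-comparable br              x∈ (here refl) = inj₁ (branch-member-↠-head br x∈)
  branch-members-comparable (∷-branch _ br) (there x∈) (there y∈) = branch-members-comparable br x∈ y∈

  branchFrom-member-↠-start : ∀ {s vs x} → IsBranchFrom s vs → x ∈ vs → x ↠ s
  branchFrom-member-↠-start (nonempty br) x∈ = branch-member-↠-head br x∈

  branchFrom-members-comparable : ∀ {s vs x y} → IsBranchFrom s vs → x ∈ vs → y ∈ vs → Comparable x y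
  branchFrom-members-comparable (nonempty br) = branch-members-comparable br

module BurlingTreeProperties {n : ℕ} (B : BurlingTree n) where
  open BurlingTree B
  open RootedTreeProperties tree

  record ArcSource (u v : Fin n) : Set where
    field
      father       : Fin n
      father-u     : IsParent father u
      u-not-last   : lastBorn father ≢ u
      father-last  : IsParent father (lastBorn father)
      branch       : IsBranchFrom (lastBorn father) (c u)

  ∉[] : ∀ {v : Fin n} → ¬ v ∈ []
  ∉[] ()

  arcSource : ∀ {u v} → Arc u v → ArcSource u v
  arcSource {u} {v} v∈cu with parent u in pu
  ... | nothing = ⊥-elim (∉[] (subst (v ∈_) c-root (subst (λ x → v ∈ c x) (nonroot-parent u pu) v∈cu)))
  ... | just w  = record
    { father      = w
    ; father-u    = pu
    ; u-not-last  = u-not-last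
    ; father-last = lastBorn-child w (λ w-leaf → w-leaf u pu)
    ; branch      = c-other u w pu u-not-last
    }
    where
    u-not-last : lastBorn w ≢ u
    u-not-last last≡u = ∉[] (subst (v ∈_) (c-lastBorn u w pu last≡u) v∈cu)

  module _ {u v} (uv : Arc u v) where
    open ArcSource (arcSource uv)

    v↠last : v ↠ lastBorn father
    v↠last = branchFrom-member-↠-start branch uv

    depth-last≡depth-source : depth (lastBorn father) ≡ depth u
    depth-last≡depth-source = trans (depth-child father-last) (sym (depth-child father-u))

    arc-depth-≤ : depth u ≤ depth v
    arc-depth-≤ = subst (_≤ depth v) depth-last≡depth-source (↠-depth-≤ v↠last)

    arc-incomparable : ¬ Comparable u v
    arc-incomparable (inj₁ u↠v) =
      u-not-last (↠-depth-≡ (u↠v ◅◅ v↠last) depth-last≡depth-source)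
    arc-incomparable (inj₂ v↠u) =
      u-not-last (↠-unique-at-depth v↠last v↠u depth-last≡depth-source)

    level-arc-sink : depth u ≡ depth v → ∀ {x} → ¬ Arc v x
    level-arc-sink d {x} vx = ∉[] (subst (x ∈_) (c-lastBorn v father father-v last≡v) vx)
      where
      last≡v : lastBorn father ≡ v
      last≡v = ↠-depth-≡ v↠last (trans depth-last≡depth-source d)
      father-v : IsParent father v
      father-v = subst (IsParent father) last≡v father-last

  out-neighbours-comparable : ∀ {u v w} → Arc u v → Arc u w → Comparable v w
  out-neighbours-comparable uv = branchFrom-members-comparable (ArcSource.branch (arcSource uv)) uv

  out-neighbours-nonadjacent : ∀ {u v w} → Arc u v → Arc u w → ¬ Adj v w
  out-neighbours-nonadjacent uv uw (inj₁ vw) = arc-incomparable vw (out-neighbours-comparable uv uw)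
  out-neighbours-nonadjacent uv uw (inj₂ wv) = arc-incomparable wv (out-neighbours-comparable uw uv)

  no-3-cycle : ∀ {a b x} → Arc a b → Arc b x → ¬ Arc x a
  no-3-cycle ab bx xa =
    level-arc-sink ab (≤-antisym (arc-depth-≤ ab) (≤-trans (arc-depth-≤ bx) (arc-depth-≤ xa))) bx

lemma3p4 : ∀ {m : ℕ} (G : Graph m) → IsBurlingGraph G → ¬ HasTriangle G
lemma3p4 G (_ , B , _ , _ , edge⇔adj) (x , y , z , _ , _ , _ , xy , yz , xz) =
  triangle-free Arc out-neighbours-nonadjacent no-3-cycle
    (to (edge⇔adj x y) xy) (to (edge⇔adj y z) yz) (to (edge⇔adj x z) xz)
  where
  open BurlingTree B using (Arc)
  open BurlingTreeProperties B
  open Equivalence
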